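{- Let $\mathcal{G}=(G,\mathcal{E})$ be a temporal graph with lifetime $t_{\max}$, $s\in V(G)$ a source, $t\in[t_{\max}]$ a time step, $\delta>0$ an integer and $\mathcal{T}$ a transmission schedule. Then $$(\delta,\mathcal{T})\text{ - }\mathrm{active}_t(\mathcal{G},s)=\bigcup_{\tau\in\mathcal{T}}(\delta,\{\tau\})\text{ - }\mathrm{active}_t(\mathcal{G},s).$$
   Context: A temporal graph $\mathcal{G}=(G,\mathcal{E})$ consists of a finite underlying graph $G=(V,E)$ and a sequence $\mathcal{E}=(E_1,\dots,E_{t_{\max}})$ of edge sets; an edge is available at time step $i$ if it lies in $E_i$. Spreading process: given source $s$, integer $\delta\ge1$ and a transmission schedule $\mathcal{T}\subseteq[t_{\max}]$ (time steps at which $s$ transmits), every vertex has a counter in $\{0,\dots,\delta\}$ and is active iff its counter is positive; initially all counters are $0$. If $s$ transmits at time step $t$, its counter is set to $\delta$ at $t$; otherwise the counter of $s$ decreases by $1$ (not below $0$) per time step. For $v\neq s$: if at time step $t$ there is an active $u$ with $uv\in E_t$, the counter of $v$ at $t+1$ is $\delta$; otherwise it is its counter at $t$ minus $1$ (not below $0$). $(\delta,\mathcal{T})\text{ - }\mathrm{active}_t(\mathcal{G},s)$ is the set of active vertices at time step $t$; $(\delta,\{\tau\})\text{ - }\mathrm{active}_t(\mathcal{G},s)$ is this set when $s$ transmits only at time step $\tau$. -}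

module Defs where

open import Data.Nat using (ℕ; zero; suc; _∸_; _≤_; _<_)
open import Data.Nat.Properties using (_≟_)
open import Data.Fin using (Fin) renaming (_≟_ to _≟ᶠ_)
open import Data.Bool using (Bool; true; false; if_then_else_; _∧_; _∨_)
open import Data.Product using (_×_)
open import Relation.Nullary.Decidable using (⌊_⌋)
open import Relation.Binary.PropositionalEquality using (_≡_)

record TemporalGraph (n : ℕ) : Set where
  field
    tmax     : ℕ
    adj      : Fin n → Fin n → Bool
    adj-sym  : ∀ u v → adj u v ≡ adj v u
    adj-irr  : ∀ v → adj v v ≡ false
    E        : ℕ → Fin n → Fin n → Bool
    E-sym    : ∀ i u v → E i u v ≡ E i v u
    E⊆G      : ∀ i u v → E i u v ≡ true → adj u v ≡ true
    E-range  : ∀ i u v → E i u v ≡ true → (1 ≤ i × i ≤ tmax)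

anyFin : ∀ {n} → (Fin n → Bool) → Bool
anyFin {zero}  f = false
anyFin {suc n} f = f Fin.zero ∨ anyFin (λ i → f (Fin.suc i))

Schedule : Set
Schedule = ℕ → Bool

single : ℕ → Schedule
single τ t = ⌊ t ≟ τ ⌋

-- counter 𝒢 s δ 𝒯 t v : the counter of v at time step t
-- (time step 0 is the initial state, where all counters are 0).
counter : ∀ {n} → TemporalGraph n → Fin n → ℕ → Schedule → ℕ → Fin n → ℕ
counter 𝒢 s δ 𝒯 zero v = 0
counter 𝒢 s δ 𝒯 (suc t) v =
  if ⌊ v ≟ᶠ s ⌋
  then (if 𝒯 (suc t) then δ else counter 𝒢 s δ 𝒯 t v ∸ 1)
  else (if anyFin (λ u → isActive u ∧ TemporalGraph.E 𝒢 t u v)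
        then δ else counter 𝒢 s δ 𝒯 t v ∸ 1)
  where
    isActive : _ → Bool
    isActive u with counter 𝒢 s δ 𝒯 t u
    ... | zero  = false
    ... | suc _ = true

Active : ∀ {n} → TemporalGraph n → Fin n → ℕ → Schedule → ℕ → Fin n → Set
Active 𝒢 s δ 𝒯 t v = 0 < counter 𝒢 s δ 𝒯 t v

{-# OPTIONS --safe #-}
-- Under a schedule 𝒯 the counter of every vertex is the maximum of its
-- counters under the single transmissions τ ∈ 𝒯 (or 0 if there is none).
-- "≥" holds because the counter is monotone in the schedule.  The maximum
-- is attained because a vertex refreshed to δ is refreshed either by a
-- transmission τ ∈ 𝒯 of the source, or by an active neighbour u, whose
-- counter is attained by some τ ∈ 𝒯; that τ alone then refreshes the
-- vertex as well.  A vertex that is not refreshed decreases in step with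
-- the τ attaining its previous value, which is not refreshed either.
module Submission where

open import Defs
open import Data.Nat using (ℕ; zero; suc; _∸_; _≤_; _<_; z≤n; s≤s)
open import Data.Nat.Properties using (≤-refl; ≤-trans; m∸n≤m; ∸-monoˡ-≤; <-≤-trans)
  renaming (_≟_ to _≟ℕ_)
open import Data.Fin using (Fin) renaming (_≟_ to _≟ᶠ_)
open import Data.Bool using (Bool; true; false; if_then_else_; _∧_; _∨_)
open import Data.Product using (_×_; _,_; ∃-syntax)
open import Data.Sum using (_⊎_; inj₁; inj₂)
open import Function using (case_of_)
open import Function.Bundles using (_⇔_; mk⇔)
open import Relation.Nullary using (yes; no; contradiction)
open import Relation.Nullary.Decidable using (⌊_⌋)
open import Relation.Binary.PropositionalEquality
  using (_≡_; refl; sym; trans; cong; cong₂; subst; module ≡-Reasoning)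

isPositive : ℕ → Bool
isPositive zero    = false
isPositive (suc _) = true

isPositive-∧-mono : ∀ {c c′ b} → c ≤ c′ → isPositive c ∧ b ≡ true → isPositive c′ ∧ b ≡ true
isPositive-∧-mono {suc _} (s≤s _) p = p

anyFin-cong : ∀ {n} {f g : Fin n → Bool} → (∀ i → f i ≡ g i) → anyFin f ≡ anyFin g
anyFin-cong {zero}  f≡g = refl
anyFin-cong {suc n} f≡g = cong₂ _∨_ (f≡g Fin.zero) (anyFin-cong (λ i → f≡g (Fin.suc i)))

anyFin⇒∃ : ∀ {n} (f : Fin n → Bool) → anyFin f ≡ true → ∃[ i ] f i ≡ true
anyFin⇒∃ {suc n} f any with f Fin.zero in f₀
... | true  = Fin.zero , f₀
... | false = let i , fi = anyFin⇒∃ (λ i → f (Fin.suc i)) any in Fin.suc i , fi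

∃⇒anyFin : ∀ {n} (f : Fin n → Bool) (i : Fin n) → f i ≡ true → anyFin f ≡ true
∃⇒anyFin f Fin.zero    fi rewrite fi = refl
∃⇒anyFin f (Fin.suc i) fi with f Fin.zero
... | true  = refl
... | false = ∃⇒anyFin (λ j → f (Fin.suc j)) i fi

anyFin-mono : ∀ {n} {f g : Fin n → Bool} →
              (∀ i → f i ≡ true → g i ≡ true) → anyFin f ≡ true → anyFin g ≡ true
anyFin-mono {f = f} {g} f⇒g any = let i , fi = anyFin⇒∃ f any in ∃⇒anyFin g i (f⇒g i fi)

single-self : ∀ τ → single τ τ ≡ true
single-self τ with τ ≟ℕ τ
... | yes _   = refl
... | no τ≢τ = contradiction refl τ≢τ

single⇒≡ : ∀ {τ t} → single τ t ≡ true → t ≡ τ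
single⇒≡ {τ} {t} p with t ≟ℕ τ
... | yes t≡τ = t≡τ

_⊆ˢ_ : Schedule → Schedule → Set
𝒮 ⊆ˢ 𝒯 = ∀ τ → 𝒮 τ ≡ true → 𝒯 τ ≡ true

single-⊆ : ∀ {𝒯 τ} → 𝒯 τ ≡ true → single τ ⊆ˢ 𝒯
single-⊆ {𝒯} 𝒯τ t p = subst (λ x → 𝒯 x ≡ true) (sym (single⇒≡ p)) 𝒯τ

module Spreading {n} (𝒢 : TemporalGraph n) (s : Fin n) (δ : ℕ) where
  open TemporalGraph 𝒢 using (E)

  count : Schedule → ℕ → Fin n → ℕ
  count = counter 𝒢 s δ

  refresh : Bool → ℕ → ℕ
  refresh b c = if b then δ else c ∸ 1

  triggered : Schedule → ℕ → Fin n → Bool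
  triggered 𝒯 t v = if ⌊ v ≟ᶠ s ⌋ then 𝒯 (suc t)
                    else anyFin (λ u → isPositive (count 𝒯 t u) ∧ E t u v)

  -- The left-hand side is the activity test local to the definition of
  -- counter; it is fixed by its use in count-suc, before the clauses below.
  isActive≡isPositive : ∀ 𝒯 t v u → _ ≡ isPositive (count 𝒯 t u) ∧ E t u v

  count-suc : ∀ 𝒯 t v → count 𝒯 (suc t) v ≡ refresh (triggered 𝒯 t v) (count 𝒯 t v)
  count-suc 𝒯 t v with ⌊ v ≟ᶠ s ⌋
  ... | true  = refl
  ... | false = cong (λ b → refresh b (count 𝒯 t v)) (anyFin-cong (isActive≡isPositive 𝒯 t v))

  isActive≡isPositive 𝒯 t v u with count 𝒯 t u
  ... | zero  = refl
  ... | suc _ = refl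

  refresh-≤δ : ∀ b {c} → c ≤ δ → refresh b c ≤ δ
  refresh-≤δ true  _   = ≤-refl
  refresh-≤δ false c≤δ = ≤-trans (m∸n≤m _ 1) c≤δ

  refresh-mono : ∀ {b b′ c c′} → (b ≡ true → b′ ≡ true) → c ≤ δ → c ≤ c′ →
                 refresh b c ≤ refresh b′ c′
  refresh-mono {b′ = true}  _    c≤δ _    = refresh-≤δ _ c≤δ
  refresh-mono {false} {false} _ _   c≤c′ = ∸-monoˡ-≤ 1 c≤c′
  refresh-mono {true}  {false} b⇒b′ _ _ = case b⇒b′ refl of λ ()

  count-≤δ : ∀ 𝒯 t v → count 𝒯 t v ≤ δ
  count-≤δ 𝒯 zero    v = z≤n
  count-≤δ 𝒯 (suc t) v rewrite count-suc 𝒯 t v = refresh-≤δ _ (count-≤δ 𝒯 t v)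

  triggered-mono : ∀ {𝒮 𝒯 t} → 𝒮 ⊆ˢ 𝒯 → (∀ u → count 𝒮 t u ≤ count 𝒯 t u) →
                   ∀ v → triggered 𝒮 t v ≡ true → triggered 𝒯 t v ≡ true
  triggered-mono {t = t} 𝒮⊆𝒯 count≤ v with ⌊ v ≟ᶠ s ⌋
  ... | true  = 𝒮⊆𝒯 (suc t)
  ... | false = anyFin-mono (λ u → isPositive-∧-mono (count≤ u))

  count-mono : ∀ {𝒮 𝒯} → 𝒮 ⊆ˢ 𝒯 → ∀ t v → count 𝒮 t v ≤ count 𝒯 t v
  count-mono 𝒮⊆𝒯 zero    v = z≤n
  count-mono {𝒮} {𝒯} 𝒮⊆𝒯 (suc t) v rewrite count-suc 𝒮 t v | count-suc 𝒯 t v =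
    refresh-mono (triggered-mono 𝒮⊆𝒯 (count-mono 𝒮⊆𝒯 t) v)
                 (count-≤δ 𝒮 t v) (count-mono 𝒮⊆𝒯 t v)

  Attained : Schedule → ℕ → Fin n → Set
  Attained 𝒯 t v = count 𝒯 t v ≡ 0 ⊎ ∃[ τ ] (𝒯 τ ≡ true × count (single τ) t v ≡ count 𝒯 t v)

  triggered-witness : ∀ {𝒯 t} → (∀ u → Attained 𝒯 t u) →
                      ∀ v → triggered 𝒯 t v ≡ true →
                      ∃[ τ ] (𝒯 τ ≡ true × triggered (single τ) t v ≡ true)
  triggered-witness {𝒯} {t} attained v trig with ⌊ v ≟ᶠ s ⌋
  ... | true  = suc t , trig , single-self (suc t)
  ... | false with anyFin⇒∃ _ trig
  ...   | u , active-edge with attained u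
  ...     | inj₁ count≡0 = case subst (λ c → isPositive c ∧ E t u v ≡ true) count≡0 active-edge of λ ()
  ...     | inj₂ (τ , 𝒯τ , count≡) =
              τ , 𝒯τ , ∃⇒anyFin _ u (subst (λ c → isPositive c ∧ E t u v ≡ true) (sym count≡) active-edge)

  untriggered-single : ∀ {𝒯 τ t v} → 𝒯 τ ≡ true → triggered 𝒯 t v ≡ false →
                       triggered (single τ) t v ≡ false
  untriggered-single {𝒯} {τ} {t} {v} 𝒯τ untrig with triggered (single τ) t v in trig
  ... | false = refl
  ... | true  = case trans (sym untrig)
                      (triggered-mono (single-⊆ 𝒯τ) (count-mono (single-⊆ 𝒯τ) t) v trig) of λ ()

  count-attained : ∀ 𝒯 t v → Attained 𝒯 t v
  count-attained 𝒯 zero    v = inj₁ refl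
  count-attained 𝒯 (suc t) v rewrite count-suc 𝒯 t v with triggered 𝒯 t v in trig
  ... | true  = let τ , 𝒯τ , trigτ = triggered-witness (count-attained 𝒯 t) v trig in
                inj₂ (τ , 𝒯τ , trans (count-suc (single τ) t v) (cong (λ b → refresh b (count (single τ) t v)) trigτ))
  ... | false with count-attained 𝒯 t v
  ...   | inj₁ count≡0 = inj₁ (cong (_∸ 1) count≡0)
  ...   | inj₂ (τ , 𝒯τ , count≡) = inj₂ (τ , 𝒯τ , decay)
    where
    open ≡-Reasoning
    decay : count (single τ) (suc t) v ≡ count 𝒯 t v ∸ 1
    decay = begin
      count (single τ) (suc t) v                          ≡⟨ count-suc (single τ) t v ⟩
      refresh (triggered (single τ) t v) (count (single τ) t v)
                                                          ≡⟨ cong₂ refresh (untriggered-single {𝒯} 𝒯τ trig) count≡ ⟩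
      count 𝒯 t v ∸ 1                                     ∎

lemma10 : ∀ {n} (𝒢 : TemporalGraph n) (s : Fin n) (t δ : ℕ) (𝒯 : Schedule)
    → 1 ≤ t → t ≤ TemporalGraph.tmax 𝒢 → 0 < δ
    → (∀ τ → 𝒯 τ ≡ true → 1 ≤ τ × τ ≤ TemporalGraph.tmax 𝒢)
    → ∀ v → Active 𝒢 s δ 𝒯 t v ⇔ (∃[ τ ] (𝒯 τ ≡ true × Active 𝒢 s δ (single τ) t v))
lemma10 𝒢 s t δ 𝒯 _ _ _ _ v = mk⇔ to from
  where
  open Spreading 𝒢 s δ
  to : Active 𝒢 s δ 𝒯 t v → ∃[ τ ] (𝒯 τ ≡ true × Active 𝒢 s δ (single τ) t v)
  to active with count-attained 𝒯 t v
  ... | inj₁ count≡0              = case subst (0 <_) count≡0 active of λ ()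
  ... | inj₂ (τ , 𝒯τ , count≡) = τ , 𝒯τ , subst (0 <_) (sym count≡) active
  from : ∃[ τ ] (𝒯 τ ≡ true × Active 𝒢 s δ (single τ) t v) → Active 𝒢 s δ 𝒯 t v
  from (τ , 𝒯τ , active) = <-≤-trans active (count-mono (single-⊆ 𝒯τ) t v)
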